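{- Let $H=(V,E)$ be a hypergraph with maximum edge degree $D$ and let $v\in V$. Then for every positive integer $N$, the number of disjoint h-trees with $N$ nodes containing $v$ is at most $(4D)^N$.
   Context: The degree of an edge $e$ is the number of other edges of $H$ intersecting $e$. An h-tree is a rooted tree in which each node $x$ is labelled by an edge $e(x)$ of $H$ and each tree edge $\{x_1,x_2\}$ is labelled by a vertex of $H$ lying in $e(x_1)\cap e(x_2)$. An h-tree is disjoint if for every two distinct nodes $x,y$, $|e(x)\cap e(y)|\leq 1$, and $e(x)\cap e(y)\neq\emptyset$ only when $x$ and $y$ are adjacent in the tree. An h-tree contains a vertex $v$ if $v\in e(x)$ for some node $x$. -}

module Defs where

open import Data.Nat using (ℕ; zero; suc; _≤_)
open import Data.Fin using (Fin; zero; suc; toℕ)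
open import Data.Fin.Subset using (Subset; _∈_; _∩_; ∣_∣; Nonempty)
open import Data.Fin.Subset.Properties using (nonempty?)
open import Data.Fin.Properties using (_≟_)
open import Data.List using (List; length; filter; allFin)
open import Data.Maybe using (Maybe; just; nothing)
import Data.Maybe as Maybe
open import Data.Sum using (_⊎_)
open import Data.Product using (Σ; ∃; _×_; _,_; proj₁; proj₂; map₁)
open import Relation.Nullary using (¬_)
open import Relation.Nullary.Decidable using (_×-dec_; ¬?)
open import Relation.Binary.PropositionalEquality using (_≡_; _≢_)
open import Function using (Injective; _↔_; Inverse)

record Hypergraph : Set where
  field
    n    : ℕ
    m    : ℕ
    edge : Fin m → Subset n
    edge-injective : Injective _≡_ _≡_ edge
open Hypergraph public

edgeDegree : (H : Hypergraph) → Fin (m H) → ℕ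
edgeDegree H i =
  length (filter (λ j → ¬? (j ≟ i) ×-dec nonempty? (edge H i ∩ edge H j)) (allFin (m H)))

MaxEdgeDegree : Hypergraph → ℕ → Set
MaxEdgeDegree H D = (∀ i → edgeDegree H i ≤ D) × (∃ λ i → edgeDegree H i ≡ D)

-- A rooted tree on node set Fin (suc k) is
-- encoded by: root = zero, and every other node (suc i) has a parent
-- (parent i) with a smaller index.  (Every finite rooted tree is isomorphic
-- to one of this form, e.g. via a BFS numbering; h-trees are counted up to
-- isomorphism below.)  Each node x is labelled by an edge (label x), and the
-- tree edge {suc i , parent i} by a vertex lying in both edges.
record HTree (H : Hypergraph) (k : ℕ) : Set where
  field
    parent   : Fin k → Fin (suc k)
    parent<  : ∀ i → toℕ (parent i) ≤ toℕ i
    label    : Fin (suc k) → Fin (m H)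
    elabel   : Fin k → Fin (n H)
    elabel∈child  : ∀ i → elabel i ∈ edge H (label (suc i))
    elabel∈parent : ∀ i → elabel i ∈ edge H (label (parent i))
open HTree public

e : ∀ {H k} → HTree H k → Fin (suc k) → Subset (n H)
e {H} T x = edge H (label T x)

ParentOf : ∀ {H k} → HTree H k → Fin (suc k) → Fin (suc k) → Set
ParentOf T x y = ∃ λ i → (x ≡ suc i) × (parent T i ≡ y)

Adjacent : ∀ {H k} → HTree H k → Fin (suc k) → Fin (suc k) → Set
Adjacent T x y = ParentOf T x y ⊎ ParentOf T y x

Disjoint : ∀ {H k} → HTree H k → Set
Disjoint T = ∀ x y → x ≢ y →
  (∣ e T x ∩ e T y ∣ ≤ 1) × (Nonempty (e T x ∩ e T y) → Adjacent T x y)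

Contains : ∀ {H k} → HTree H k → Fin (n H) → Set
Contains T v = ∃ λ x → v ∈ e T x

up : ∀ {H k} → HTree H k → Fin (suc k) → Maybe (Fin (suc k) × Fin (n H))
up T zero    = nothing
up T (suc i) = just (parent T i , elabel T i)

-- Isomorphism of h-trees: a bijection of nodes preserving the root, the
-- parent relation, the node labels and the tree-edge labels.
Iso : ∀ {H k} → HTree H k → HTree H k → Set
Iso {H} {k} T U = Σ (Fin (suc k) ↔ Fin (suc k)) λ σ →
  let f = Inverse.to σ in
  (∀ x → label U (f x) ≡ label T x) ×
  (∀ x → up U (f x) ≡ Maybe.map (map₁ f) (up T x))

DisjointHTreeContaining : (H : Hypergraph) → Fin (n H) → ℕ → Set
DisjointHTreeContaining H v k = Σ (HTree H k) λ T → Disjoint T × Contains T v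

-- "The number of (isomorphism classes of) objects in A is at most K":
-- there is a map into Fin K identifying only isomorphic objects.
AtMostUpTo : (A : Set) → (A → A → Set) → ℕ → Set
AtMostUpTo A _≅_ K = Σ (A → Fin K) λ c → ∀ a b → c a ≡ c b → a ≅ b

-- Apart from a degenerate case (two nodes labelled by the same edge, which forces the
-- tree to have exactly two nodes), a disjoint h-tree has pairwise distinct labels, and two
-- of its nodes are adjacent exactly when their edges meet.  Hence the tree is determined
-- up to isomorphism by its set of edges together with the edge of its root.  This set is
-- connected in the line graph of H, whose degrees are at most D, so it is traversed by a
-- depth-first walk that starts at an edge containing v and ends at the root's edge.  The
-- walk makes N - 1 descents, each to one of at most D neighbours, and at most N - 1
-- returns, so it has fewer than 2 (4D)^(N-1) codes; the starting edge is a fixed edge g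
-- through v or one of its at most D neighbours.  Altogether (D + 1) 2 (4D)^(N-1) ≤ (4D)^N.
module Submission where

open import Defs
open import Data.Nat using (ℕ; zero; suc; _+_; _*_; _^_; _≤_; _<_; z≤n; s≤s; z<s; NonZero)
open import Data.Nat.Base using (>-nonZero)
open import Data.Nat.Properties
open import Data.Nat.DivMod using (_%_; m<n⇒m%n≡m; [m+kn]%n≡m%n)
open import Data.Nat.Tactic.RingSolver using (solve-∀)
open import Data.Fin as Fin using (Fin; zero; suc; toℕ; inject₁; fromℕ; lower₁)
open import Data.Fin.Properties as Finₚ using (toℕ-inject₁; inject₁-lower₁)
import Data.Fin.Induction as Finᵢ
open import Data.Fin.Relation.Unary.Top using (view; ‵fromℕ; ‵inject₁)
open import Data.Fin.Subset using (Subset; _∈_; _∩_; ∣_∣; Nonempty; ⁅_⁆; _⊆_)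
open import Data.Fin.Subset.Properties
  using (nonempty?; _∈?_; x∈p∩q⁺; p⊂q⇒∣p∣<∣q∣; x∈⁅y⁆⇒x≡y; x≢y⇒x∉⁅y⁆; ∣⁅x⁆∣≡1)
open import Data.Product using (Σ; ∃; ∃₂; _×_; _,_; proj₁; proj₂; map₁; map₂; swap)
open import Data.Sum as Sum using (_⊎_; inj₁; inj₂)
open import Data.Maybe as Maybe using (just)
open import Data.Unit using (⊤; tt)
open import Data.Empty using (⊥; ⊥-elim)
open import Data.List using (List; []; _∷_; _++_; filter; allFin)
open import Data.List.Relation.Unary.Any as Any using (here; there)
open import Data.List.Relation.Unary.All using (All; []; _∷_)
import Data.List.Relation.Unary.All.Properties as Allₚ
open import Data.List.Membership.Propositional using () renaming (_∈_ to _∈ₗ_)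
open import Data.List.Membership.Propositional.Properties using (∈-filter⁺; ∈-allFin)
open import Function using (_∘_)
open import Function.Bundles using (mk↔ₛ′)
open import Induction.WellFounded using (Acc; acc)
open import Relation.Nullary using (¬_; yes; no; contradiction)
open import Relation.Nullary.Decidable using (_×-dec_; ¬?)
open import Relation.Binary.PropositionalEquality

-- Walks with a stack

data Move : Set where
  ascend  : Move
  descend : ℕ → Move

Word : Set
Word = List Move

ascents descents : Word → ℕ
ascents []              = 0
ascents (ascend ∷ w)    = suc (ascents w)
ascents (descend _ ∷ w) = ascents w
descents []              = 0
descents (ascend ∷ w)    = descents w
descents (descend _ ∷ w) = suc (descents w)

ascents-excursion : ∀ w₁ {w₂} j → ascents (w₁ ++ descend j ∷ ascend ∷ w₂) ≡ suc (ascents (w₁ ++ w₂))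
ascents-excursion []               j = refl
ascents-excursion (ascend ∷ w₁)    j = cong suc (ascents-excursion w₁ j)
ascents-excursion (descend _ ∷ w₁) j = ascents-excursion w₁ j

descents-excursion : ∀ w₁ {w₂} j → descents (w₁ ++ descend j ∷ ascend ∷ w₂) ≡ suc (descents (w₁ ++ w₂))
descents-excursion []               j = refl
descents-excursion (ascend ∷ w₁)    j = descents-excursion w₁ j
descents-excursion (descend _ ∷ w₁) j = cong suc (descents-excursion w₁ j)

-- 'descend j' moves to the j-th neighbour and pushes the current vertex; 'ascend' pops
-- back to the vertex the walk came from (and stays put on an empty stack).
module Walk {V : Set} (neighbour : V → ℕ → V) where

  State : Set
  State = V × List V

  move : Move → State → State
  move (descend j) (t , s)      = neighbour t j , t ∷ s
  move ascend      (t , [])     = t , []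
  move ascend      (t , t′ ∷ s) = t′ , s

  run : State → Word → State
  run st []      = st
  run st (m ∷ w) = run (move m st) w

  trail visits : State → Word → List V
  trail st w = proj₁ st ∷ visits st w
  visits st []      = []
  visits st (m ∷ w) = trail (move m st) w

  trail-split : ∀ {t} st w → t ∈ₗ trail st w →
                ∃₂ λ w₁ w₂ → w₁ ++ w₂ ≡ w × proj₁ (run st w₁) ≡ t
  trail-split st w       (here refl) = [] , w , refl , refl
  trail-split st (m ∷ w) (there p) with trail-split (move m st) w p
  ... | w₁ , w₂ , refl , at = m ∷ w₁ , w₂ , refl , at

  run-excursion : ∀ st w₁ {w₂} j → run st (w₁ ++ descend j ∷ ascend ∷ w₂) ≡ run st (w₁ ++ w₂)
  run-excursion st []       j = refl
  run-excursion st (m ∷ w₁) j = run-excursion (move m st) w₁ j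

  trail-excursion⁺ : ∀ {t} st w₁ {w₂} j →
                     t ∈ₗ trail st (w₁ ++ w₂) → t ∈ₗ trail st (w₁ ++ descend j ∷ ascend ∷ w₂)
  trail-excursion⁺ st []       j p         = there (there p)
  trail-excursion⁺ st (m ∷ w₁) j (here eq) = here eq
  trail-excursion⁺ st (m ∷ w₁) j (there p) = there (trail-excursion⁺ (move m st) w₁ j p)

  trail-excursion-new : ∀ st w₁ {w₂} j →
                        neighbour (proj₁ (run st w₁)) j ∈ₗ trail st (w₁ ++ descend j ∷ ascend ∷ w₂)
  trail-excursion-new st []       j = there (here refl)
  trail-excursion-new st (m ∷ w₁) j = there (trail-excursion-new (move m st) w₁ j)

  trail-excursion⁻ : ∀ {t} st w₁ {w₂} j → t ∈ₗ trail st (w₁ ++ descend j ∷ ascend ∷ w₂) →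
                     t ≡ neighbour (proj₁ (run st w₁)) j ⊎ t ∈ₗ trail st (w₁ ++ w₂)
  trail-excursion⁻ st []       j (here eq)         = inj₂ (here eq)
  trail-excursion⁻ st []       j (there (here eq)) = inj₁ eq
  trail-excursion⁻ st []       j (there (there p)) = inj₂ p
  trail-excursion⁻ st (m ∷ w₁) j (here eq)         = inj₂ (here eq)
  trail-excursion⁻ st (m ∷ w₁) j (there p)         =
    Sum.map₂ there (trail-excursion⁻ (move m st) w₁ j p)

-- Coding words by numbers

digits-injective : ∀ {n a b} x y .{{_ : NonZero n}} →
                   a < n → b < n → a + x * n ≡ b + y * n → a ≡ b × x ≡ y
digits-injective {n} {a} {b} x y a<n b<n eq =
  a≡b , *-cancelʳ-≡ x y n (+-cancelˡ-≡ a _ _ (trans eq (cong (_+ y * n) (sym a≡b))))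
  where
  open ≡-Reasoning
  a≡b : a ≡ b
  a≡b = begin
    a               ≡⟨ m<n⇒m%n≡m a<n ⟨
    a % n           ≡⟨ [m+kn]%n≡m%n a x n ⟨
    (a + x * n) % n ≡⟨ cong (_% n) eq ⟩
    (b + y * n) % n ≡⟨ [m+kn]%n≡m%n b y n ⟩
    b % n           ≡⟨ m<n⇒m%n≡m b<n ⟩
    b               ∎

digits-bound : ∀ {n a x X} → a < n → x < X → a + x * n < X * n
digits-bound {n} {a} {x} {X} a<n x<X = begin-strict
  a + x * n <⟨ +-monoˡ-< (x * n) a<n ⟩
  suc x * n ≤⟨ *-monoˡ-≤ n x<X ⟩
  X * n     ∎
  where open ≤-Reasoning

Bounded : ℕ → Move → Set
Bounded D ascend      = ⊤
Bounded D (descend j) = j < D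

-- The last digit in base 2 tells the kind of the first move; a descent then carries
-- its index as a digit in base D.
encode : ℕ → Word → ℕ
encode D []              = 0
encode D (ascend ∷ w)    = suc (encode D w) * 2
encode D (descend j ∷ w) = 1 + (j + encode D w * D) * 2

encode-injective : ∀ {D} w w′ → All (Bounded D) w → All (Bounded D) w′ →
                   encode D w ≡ encode D w′ → w ≡ w′
encode-injective []              []              _ _ _  = refl
encode-injective []              (ascend ∷ _)    _ _ ()
encode-injective []              (descend _ ∷ _) _ _ ()
encode-injective (ascend ∷ _)    []              _ _ ()
encode-injective (descend _ ∷ _) []              _ _ ()
encode-injective (ascend ∷ w) (ascend ∷ w′) (_ ∷ bw) (_ ∷ bw′) eq =
  cong (ascend ∷_) (encode-injective w w′ bw bw′ (suc-injective (*-cancelʳ-≡ _ _ 2 eq)))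
encode-injective {D} (ascend ∷ w) (descend j′ ∷ w′) _ _ eq
  with () ← proj₁ (digits-injective {a = 0} (suc (encode D w)) (j′ + encode D w′ * D) z<s (s≤s z<s) eq)
encode-injective {D} (descend j ∷ w) (ascend ∷ w′) _ _ eq
  with () ← proj₁ (digits-injective {a = 1} (j + encode D w * D) (suc (encode D w′)) (s≤s z<s) z<s eq)
encode-injective {D} (descend j ∷ w) (descend j′ ∷ w′) (j<D ∷ bw) (j′<D ∷ bw′) eq
  with refl , same ← digits-injective {a = 1} (j + encode D w * D) (j′ + encode D w′ * D)
                                      (s≤s z<s) (s≤s z<s) eq
  with refl , same′ ← digits-injective (encode D w) (encode D w′) {{>-nonZero (≤-trans z<s j<D)}}
                                       j<D j′<D same
  = cong (descend j ∷_) (encode-injective w w′ bw bw′ same′)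

encode-bound : ∀ {D} w → All (Bounded D) w → 2 + encode D w ≤ 2 ^ suc (ascents w) * (2 * D) ^ descents w
encode-bound []                  []         = ≤-refl
encode-bound {D} (ascend ∷ w)    (_ ∷ bw)   = begin
  (2 + c) * 2 ≤⟨ *-monoˡ-≤ 2 (encode-bound w bw) ⟩
  (P * Y) * 2 ≡⟨ regroup P Y ⟩
  (2 * P) * Y ∎
  where
  open ≤-Reasoning
  c P Y : ℕ
  c = encode D w
  P = 2 ^ suc (ascents w)
  Y = (2 * D) ^ descents w
  regroup : ∀ p y → (p * y) * 2 ≡ (2 * p) * y
  regroup = solve-∀
encode-bound {D} (descend j ∷ w) (j<D ∷ bw) = begin
  1 + (suc j + c * D) * 2 ≤⟨ s≤s (*-monoˡ-≤ 2 (+-monoˡ-≤ (c * D) j<D)) ⟩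
  1 + (D + c * D) * 2     ≤⟨ +-monoˡ-≤ _ (≤-trans (≤-trans z<s j<D) (m≤m*n D 2)) ⟩
  D * 2 + (D + c * D) * 2 ≡⟨ factor D c ⟩
  (2 + c) * (2 * D)       ≤⟨ *-monoˡ-≤ (2 * D) (encode-bound w bw) ⟩
  (P * Y) * (2 * D)       ≡⟨ regroup P Y D ⟩
  P * ((2 * D) * Y)       ∎
  where
  open ≤-Reasoning
  c P Y : ℕ
  c = encode D w
  P = 2 ^ suc (ascents w)
  Y = (2 * D) ^ descents w
  factor : ∀ d c → d * 2 + (d + c * d) * 2 ≡ (2 + c) * (2 * d)
  factor = solve-∀
  regroup : ∀ p y d → (p * y) * (2 * d) ≡ p * ((2 * d) * y)
  regroup = solve-∀

2^k*[2D]^k≡[4D]^k : ∀ D k → 2 ^ k * (2 * D) ^ k ≡ (4 * D) ^ k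
2^k*[2D]^k≡[4D]^k D zero    = refl
2^k*[2D]^k≡[4D]^k D (suc k) =
  trans (regroup (2 ^ k) ((2 * D) ^ k) D) (cong ((4 * D) *_) (2^k*[2D]^k≡[4D]^k D k))
  where
  regroup : ∀ p y d → (2 * p) * ((2 * d) * y) ≡ (4 * d) * (p * y)
  regroup = solve-∀

encode< : ∀ {D k} w → 1 ≤ D → All (Bounded D) w → ascents w ≤ k → descents w ≤ k →
          encode D w < 2 * (4 * D) ^ k
encode< {D} {k} w 1≤D bw a≤k d≤k = begin-strict
  encode D w                                 <⟨ m<n+m _ z<s ⟩
  2 + encode D w                             ≤⟨ encode-bound w bw ⟩
  2 ^ suc (ascents w) * (2 * D) ^ descents w ≤⟨ *-mono-≤ (^-monoʳ-≤ 2 (s≤s a≤k))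
                                                        (^-monoʳ-≤ (2 * D) {{2D≢0}} d≤k) ⟩
  2 * 2 ^ k * (2 * D) ^ k                    ≡⟨ *-assoc 2 (2 ^ k) _ ⟩
  2 * (2 ^ k * (2 * D) ^ k)                  ≡⟨ cong (2 *_) (2^k*[2D]^k≡[4D]^k D k) ⟩
  2 * (4 * D) ^ k                            ∎
  where
  open ≤-Reasoning
  2D≢0 : NonZero (2 * D)
  2D≢0 = m*n≢0 2 D {{_}} {{>-nonZero 1≤D}}

-- Disjoint h-trees

∣p∣≤1∧x∈p∧y∈p⇒x≡y : ∀ {n} {p : Subset n} {x y} → ∣ p ∣ ≤ 1 → x ∈ p → y ∈ p → x ≡ y
∣p∣≤1∧x∈p∧y∈p⇒x≡y {p = p} {x} {y} ∣p∣≤1 x∈p y∈p with x Finₚ.≟ y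
... | yes x≡y = x≡y
... | no  x≢y = contradiction (≤-trans 1<∣p∣ ∣p∣≤1) (<-irrefl refl)
  where
  ⁅x⁆⊆p : ⁅ x ⁆ ⊆ p
  ⁅x⁆⊆p z∈⁅x⁆ = subst (_∈ p) (sym (x∈⁅y⁆⇒x≡y x z∈⁅x⁆)) x∈p
  1<∣p∣ : 1 < ∣ p ∣
  1<∣p∣ = subst (_< ∣ p ∣) (∣⁅x⁆∣≡1 x) (p⊂q⇒∣p∣<∣q∣ (⁅x⁆⊆p , y , y∈p , x≢y⇒x∉⁅y⁆ (x≢y ∘ sym)))

module _ {H : Hypergraph} where

  private variable
    k : ℕ
    x y z : Fin (suc k)

  child≢parent : (T : HTree H k) (i : Fin k) → suc i ≢ parent T i
  child≢parent T i eq = <-irrefl refl (≤-trans (≤-reflexive (cong toℕ eq)) (parent< T i))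

  parent-zero : (T : HTree H (suc k)) → parent T zero ≡ zero
  parent-zero T = Finₚ.toℕ-injective (n≤0⇒n≡0 (parent< T zero))

  parent-below : (T : HTree H k) → ParentOf T x y → toℕ y < toℕ x
  parent-below T (i , refl , refl) = s≤s (parent< T i)

  parent-unique : (T : HTree H k) → ParentOf T x y → ParentOf T x z → y ≡ z
  parent-unique T (i , refl , refl) (_ , refl , refl) = refl

  root-has-no-parent : (T : HTree H k) → ¬ ParentOf T zero y
  root-has-no-parent T (_ , () , _)

  no-triangle : (T : HTree H k) → x ≢ y → y ≢ z → z ≢ x →
                Adjacent T x y → Adjacent T y z → Adjacent T z x → ⊥
  no-triangle T x≢y y≢z z≢x (inj₁ xy) _ (inj₂ xz) = y≢z (parent-unique T xy xz)
  no-triangle T x≢y y≢z z≢x (inj₂ yx) (inj₁ yz) _ = z≢x (sym (parent-unique T yx yz))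
  no-triangle T x≢y y≢z z≢x _ (inj₂ zy) (inj₁ zx) = x≢y (sym (parent-unique T zy zx))
  no-triangle T x≢y y≢z z≢x (inj₁ xy) (inj₁ yz) (inj₁ zx) =
    <-irrefl refl (<-trans (<-trans (parent-below T xy) (parent-below T zx)) (parent-below T yz))
  no-triangle T x≢y y≢z z≢x (inj₂ yx) (inj₂ zy) (inj₂ xz) =
    <-irrefl refl (<-trans (<-trans (parent-below T yx) (parent-below T zy)) (parent-below T xz))

  child-meets-parent : (T : HTree H k) (p : ParentOf T x y) →
                       elabel T (proj₁ p) ∈ e T x × elabel T (proj₁ p) ∈ e T y
  child-meets-parent T (i , refl , refl) = elabel∈child T i , elabel∈parent T i

  up-of-child : (T : HTree H k) (p : ParentOf T x y) → up T x ≡ just (y , elabel T (proj₁ p))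
  up-of-child T (i , refl , refl) = refl

  adjacent⇒meet : (T : HTree H k) → Adjacent T x y → ∃ λ t → t ∈ e T x × t ∈ e T y
  adjacent⇒meet T (inj₁ p) = _ , child-meets-parent T p
  adjacent⇒meet T (inj₂ p) = _ , swap (child-meets-parent T p)

  meet⇒adjacent : (T : HTree H k) → Disjoint T → x ≢ y → ∀ {t} → t ∈ e T x → t ∈ e T y →
                  Adjacent T x y
  meet⇒adjacent T dT x≢y t∈x t∈y = proj₂ (dT _ _ x≢y) (_ , x∈p∩q⁺ (t∈x , t∈y))

  shared-vertex-unique : (T : HTree H k) → Disjoint T → x ≢ y → ∀ {a b} →
                         a ∈ e T x → a ∈ e T y → b ∈ e T x → b ∈ e T y → a ≡ b
  shared-vertex-unique T dT x≢y a∈x a∈y b∈x b∈y =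
    ∣p∣≤1∧x∈p∧y∈p⇒x≡y (proj₁ (dT _ _ x≢y)) (x∈p∩q⁺ (a∈x , a∈y)) (x∈p∩q⁺ (b∈x , b∈y))

  adjacent-relabel : (T : HTree H k) → Disjoint T → z ≢ y → label T x ≡ label T y →
                     Adjacent T z x → Adjacent T z y
  adjacent-relabel T dT z≢y same zx with adjacent⇒meet T zx
  ... | t , t∈z , t∈x = meet⇒adjacent T dT z≢y t∈z (subst (λ f → t ∈ edge H f) same t∈x)

  elabel∈root : (T : HTree H (suc k)) → elabel T zero ∈ e T zero
  elabel∈root T = subst (λ y → elabel T zero ∈ e T y) (parent-zero T) (elabel∈parent T zero)

  edge-nonempty : (T : HTree H (suc k)) (x : Fin (suc (suc k))) → ∃ λ t → t ∈ e T x
  edge-nonempty T zero    = _ , elabel∈root T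
  edge-nonempty T (suc i) = _ , elabel∈child T i

  LoopFree : HTree H k → Set
  LoopFree T = ∀ i → label T (suc i) ≢ label T (parent T i)

  Degenerate : HTree H k → Set
  Degenerate T = ∃ λ i → label T (suc i) ≡ label T (parent T i)

  loop-free-or-degenerate : (T : HTree H k) → LoopFree T ⊎ Degenerate T
  loop-free-or-degenerate T with Finₚ.any? (λ i → label T (suc i) Finₚ.≟ label T (parent T i))
  ... | yes degenerate  = inj₂ degenerate
  ... | no  ¬degenerate = inj₁ (λ i same → ¬degenerate (i , same))

  label-injective : (T : HTree H k) → Disjoint T → LoopFree T → label T x ≡ label T y → x ≡ y
  label-injective {zero}  {x = zero} {zero} T dT lf same = refl
  label-injective {suc k} {x = x}    {y}    T dT lf same with x Finₚ.≟ y
  ... | yes x≡y = x≡y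
  ... | no  x≢y with edge-nonempty T x
  ...   | t , t∈x with meet⇒adjacent T dT x≢y t∈x (subst (λ f → t ∈ edge H f) same t∈x)
  ...     | inj₁ (i , refl , refl) = ⊥-elim (lf i same)
  ...     | inj₂ (i , refl , refl) = ⊥-elim (lf i (sym same))

  third-node : (T : HTree H (suc (suc k))) (i : Fin (suc (suc k))) →
               ∃ λ z → z ≢ suc i × z ≢ parent T i × (Adjacent T z (suc i) ⊎ Adjacent T z (parent T i))
  third-node T i with parent T i in eq
  ... | suc i′ = parent T i′
               , Finₚ.<⇒≢ (s≤s (≤-trans (parent< T i′) (≤-trans (n≤1+n _) i′<i)))
               , Finₚ.<⇒≢ (s≤s (parent< T i′))
               , inj₂ (inj₂ (i′ , refl , refl))
    where
    i′<i : suc (toℕ i′) ≤ toℕ i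
    i′<i = subst (_≤ toℕ i) (cong toℕ eq) (parent< T i)
  third-node T zero     | zero with parent T (suc zero) in eq₁ | parent< T (suc zero)
  ... | zero        | _ = suc (suc zero) , (λ ()) , (λ ()) , inj₂ (inj₁ (suc zero , refl , eq₁))
  ... | suc zero    | _ = suc (suc zero) , (λ ()) , (λ ()) , inj₁ (inj₁ (suc zero , refl , eq₁))
  ... | suc (suc _) | s≤s ()
  third-node T (suc i″) | zero = suc zero , (λ ()) , (λ ()) , inj₂ (inj₁ (zero , refl , parent-zero T))

  -- A third node meeting one of two nodes with the same edge meets both: a triangle.
  degenerate-size : (T : HTree H k) → Disjoint T → Degenerate T → k ≡ 1
  degenerate-size {zero}        T dT (() , _)
  degenerate-size {suc zero}    T dT _ = refl
  degenerate-size {suc (suc k)} T dT (i , same) with third-node T i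
  ... | z , z≢c , z≢p , adj =
    ⊥-elim (no-triangle T z≢c (child≢parent T i) (z≢p ∘ sym) zc (inj₁ (i , refl , refl)) (Sum.swap zp))
    where
    zc : Adjacent T z (suc i)
    zc = Sum.[ (λ a → a) , adjacent-relabel T dT z≢c (sym same) ] adj
    zp : Adjacent T z (parent T i)
    zp = Sum.[ adjacent-relabel T dT z≢p same , (λ a → a) ] adj

  degenerate-labels : (T : HTree H 1) → Degenerate T → ∀ x → label T x ≡ label T zero
  degenerate-labels T _             zero       = refl
  degenerate-labels T (zero , same) (suc zero) = trans same (cong (label T) (parent-zero T))

  degenerate-iso : (T U : HTree H k) → Disjoint T → Degenerate T → Degenerate U →
                   label T x ≡ label U y → Iso T U
  degenerate-iso {x = x} {y} T U dT dgT dgU same with degenerate-size T dT dgT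
  ... | refl = mk↔ₛ′ (λ z → z) (λ z → z) (λ _ → refl) (λ _ → refl) , same-labels , same-ups
    where
    same-labels : ∀ z → label U z ≡ label T z
    same-labels z = begin
      label U z    ≡⟨ degenerate-labels U dgU z ⟩
      label U zero ≡⟨ degenerate-labels U dgU y ⟨
      label U y    ≡⟨ same ⟨
      label T x    ≡⟨ degenerate-labels T dgT x ⟩
      label T zero ≡⟨ degenerate-labels T dgT z ⟨
      label T z    ∎
      where open ≡-Reasoning
    to-T : ∀ {a} z → a ∈ e U z → a ∈ e T z
    to-T z = subst (λ f → _ ∈ edge H f) (same-labels z)
    same-ups : ∀ z → up U z ≡ Maybe.map (map₁ (λ z → z)) (up T z)
    same-ups zero       = refl
    same-ups (suc zero) = cong just (cong₂ _,_
      (trans (parent-zero U) (sym (parent-zero T)))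
      (shared-vertex-unique T dT (λ ())
        (to-T (suc zero) (elabel∈child U zero)) (to-T zero (elabel∈root U))
        (elabel∈child T zero) (elabel∈root T)))

  module _ {T U : HTree H k} (dT : Disjoint T) (dU : Disjoint U) (lfT : LoopFree T) (lfU : LoopFree U)
           (T⊆U : ∀ x → ∃ λ y → label U y ≡ label T x) (U⊆T : ∀ y → ∃ λ x → label T x ≡ label U y)
           (same-root : label T zero ≡ label U zero) where

    private
      σ σ⁻¹ : Fin (suc k) → Fin (suc k)
      σ   x = proj₁ (T⊆U x)
      σ⁻¹ y = proj₁ (U⊆T y)

      σ-label : ∀ x → label U (σ x) ≡ label T x
      σ-label x = proj₂ (T⊆U x)

      σ⁻¹∘σ : ∀ x → σ⁻¹ (σ x) ≡ x
      σ⁻¹∘σ x = label-injective T dT lfT (trans (proj₂ (U⊆T (σ x))) (σ-label x))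

      σ∘σ⁻¹ : ∀ y → σ (σ⁻¹ y) ≡ y
      σ∘σ⁻¹ y = label-injective U dU lfU (trans (σ-label (σ⁻¹ y)) (proj₂ (U⊆T y)))

      σ-injective : ∀ {x x′} → σ x ≡ σ x′ → x ≡ x′
      σ-injective {x} {x′} eq = trans (sym (σ⁻¹∘σ x)) (trans (cong σ⁻¹ eq) (σ⁻¹∘σ x′))

      σ-root : σ zero ≡ zero
      σ-root = label-injective U dU lfU (trans (σ-label zero) same-root)

      to-U : ∀ {a} x → a ∈ e T x → a ∈ e U (σ x)
      to-U x = subst (λ f → _ ∈ edge H f) (sym (σ-label x))

      to-T : ∀ {a} x → a ∈ e U (σ x) → a ∈ e T x
      to-T x = subst (λ f → _ ∈ edge H f) (σ-label x)

      σ-adjacent : ∀ i → Adjacent U (σ (suc i)) (σ (parent T i))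
      σ-adjacent i = meet⇒adjacent U dU (child≢parent T i ∘ σ-injective)
                       (to-U (suc i) (elabel∈child T i)) (to-U (parent T i) (elabel∈parent T i))

      σ-parent : ∀ i → Acc Fin._<_ i → ParentOf U (σ (suc i)) (σ (parent T i))
      σ-parent-reversed : ∀ i → Acc Fin._<_ i → ¬ ParentOf U (σ (parent T i)) (σ (suc i))

      σ-parent i rec with σ-adjacent i
      ... | inj₁ child    = child
      ... | inj₂ reversed = ⊥-elim (σ-parent-reversed i rec reversed)

      -- The image of the root is the root, and the image of any other parent already has
      -- its own parent's image as parent, by induction.
      σ-parent-reversed i (acc rs) reversed with parent T i in eq
      ... | zero   = root-has-no-parent U (subst (λ r → ParentOf U r (σ (suc i))) σ-root reversed)
      ... | suc i′ = <-asym i<i′ i′<i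
        where
        i′<i : suc (toℕ i′) ≤ toℕ i
        i′<i = subst (_≤ toℕ i) (cong toℕ eq) (parent< T i)
        back : parent T i′ ≡ suc i
        back = σ-injective (parent-unique U (σ-parent i′ (rs i′<i)) reversed)
        i<i′ : suc (toℕ i) ≤ toℕ i′
        i<i′ = subst (_≤ toℕ i′) (cong toℕ back) (parent< T i′)

      σ-up : ∀ x → up U (σ x) ≡ Maybe.map (map₁ σ) (up T x)
      σ-up zero    = cong (up U) σ-root
      σ-up (suc i) = trans (up-of-child U p) (cong (λ a → just (σ (parent T i) , a)) same-vertex)
        where
        p : ParentOf U (σ (suc i)) (σ (parent T i))
        p = σ-parent i (Finᵢ.<-wellFounded i)
        same-vertex : elabel U (proj₁ p) ≡ elabel T i
        same-vertex = shared-vertex-unique T dT (child≢parent T i)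
          (to-T (suc i) (proj₁ (child-meets-parent U p)))
          (to-T (parent T i) (proj₂ (child-meets-parent U p)))
          (elabel∈child T i) (elabel∈parent T i)

    iso-of-same-labels : Iso T U
    iso-of-same-labels = mk↔ₛ′ σ σ⁻¹ σ∘σ⁻¹ σ⁻¹∘σ , σ-label , σ-up

-- Walks representing h-trees

lookupOr : {A : Set} → A → List A → ℕ → A
lookupOr d []       _       = d
lookupOr d (x ∷ xs) zero    = x
lookupOr d (x ∷ xs) (suc r) = lookupOr d xs r

position : {A : Set} {x : A} {xs : List A} → x ∈ₗ xs → ℕ
position p = toℕ (Any.index p)

lookupOr-position : ∀ {A : Set} {d x : A} {xs} (p : x ∈ₗ xs) → lookupOr d xs (position p) ≡ x
lookupOr-position (here refl) = refl
lookupOr-position (there p)   = lookupOr-position p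

neighbours : (H : Hypergraph) → Fin (m H) → List (Fin (m H))
neighbours H i = filter (λ j → ¬? (j Finₚ.≟ i) ×-dec nonempty? (edge H i ∩ edge H j)) (allFin (m H))

module _ {H : Hypergraph} where

  private variable
    k : ℕ

  ∈-neighbours : ∀ {i j} → j ≢ i → Nonempty (edge H i ∩ edge H j) → j ∈ₗ neighbours H i
  ∈-neighbours j≢i meet = ∈-filter⁺ _ (∈-allFin _) (j≢i , meet)

  parent∈neighbours : (T : HTree H k) → LoopFree T → ∀ i →
                      label T (parent T i) ∈ₗ neighbours H (label T (suc i))
  parent∈neighbours T lf i =
    ∈-neighbours (lf i ∘ sym) (_ , x∈p∩q⁺ (elabel∈child T i , elabel∈parent T i))

  child∈neighbours : (T : HTree H k) → LoopFree T → ∀ i →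
                     label T (suc i) ∈ₗ neighbours H (label T (parent T i))
  child∈neighbours T lf i =
    ∈-neighbours (lf i) (_ , x∈p∩q⁺ (elabel∈parent T i , elabel∈child T i))

  parent-lowered : (T : HTree H (suc k)) (i : Fin (suc k)) → ∃ λ p → inject₁ p ≡ parent T i
  parent-lowered {k} T i = lower₁ (parent T i) k+1≢ , inject₁-lower₁ (parent T i) k+1≢
    where
    k+1≢ : suc k ≢ toℕ (parent T i)
    k+1≢ = >⇒≢ (≤-<-trans (parent< T i) (Finₚ.toℕ<n i))

  drop-last : HTree H (suc k) → HTree H k
  drop-last {k} T = record
    { parent        = λ i → proj₁ (lowered i)
    ; parent<       = λ i → begin
        toℕ (proj₁ (lowered i))           ≡⟨ toℕ-inject₁ _ ⟨
        toℕ (inject₁ (proj₁ (lowered i))) ≡⟨ cong toℕ (proj₂ (lowered i)) ⟩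
        toℕ (parent T (inject₁ i))        ≤⟨ parent< T (inject₁ i) ⟩
        toℕ (inject₁ i)                   ≡⟨ toℕ-inject₁ i ⟩
        toℕ i                             ∎
    ; label         = λ x → label T (inject₁ x)
    ; elabel        = λ i → elabel T (inject₁ i)
    ; elabel∈child  = λ i → elabel∈child T (inject₁ i)
    ; elabel∈parent = λ i → subst (λ y → elabel T (inject₁ i) ∈ e T y) (sym (proj₂ (lowered i)))
                                  (elabel∈parent T (inject₁ i))
    }
    where
    open ≤-Reasoning
    lowered : (i : Fin k) → ∃ λ p → inject₁ p ≡ parent T (inject₁ i)
    lowered i = parent-lowered T (inject₁ i)

  drop-last-loop-free : (T : HTree H (suc k)) → LoopFree T → LoopFree (drop-last T)
  drop-last-loop-free T lf i same =
    lf (inject₁ i) (trans same (cong (label T) (proj₂ (parent-lowered T (inject₁ i)))))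

module Representation {H : Hypergraph} {D : ℕ} (degree≤D : ∀ i → edgeDegree H i ≤ D) where

  -- Out-of-range indices are junk: they stay at i.
  neighbour : Fin (m H) → ℕ → Fin (m H)
  neighbour i = lookupOr i (neighbours H i)

  open Walk neighbour public

  position<D : ∀ {i j} (p : j ∈ₗ neighbours H i) → position p < D
  position<D {i} p = ≤-trans (Finₚ.toℕ<n (Any.index p)) (degree≤D i)

  record Represents {k} (T : HTree H k) (st : State) (w : Word) : Set where
    field
      bounded      : All (Bounded D) w
      ascents≤     : ascents w ≤ k
      descents≤    : descents w ≤ k
      covers       : ∀ x → label T x ∈ₗ trail st w
      only         : ∀ {t} → t ∈ₗ trail st w → ∃ λ x → label T x ≡ t
      ends-at-root : proj₁ (run st w) ≡ label T zero

  open Represents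

  module _ {k} (T : HTree H (suc k)) where

    private
      leaf : Fin (suc (suc k))
      leaf = fromℕ (suc k)

      from-drop-last : ∀ {t} → (∃ λ y → label (drop-last T) y ≡ t) → ∃ λ x → label T x ≡ t
      from-drop-last (y , eq) = inject₁ y , eq

    represents-descend : ∀ {s w} j → j < D →
                         Represents (drop-last T) (neighbour (label T leaf) j , label T leaf ∷ s) w →
                         Represents T (label T leaf , s) (descend j ∷ w)
    represents-descend {s} {w} j j<D R = record
      { bounded      = j<D ∷ bounded R
      ; ascents≤     = m≤n⇒m≤1+n (ascents≤ R)
      ; descents≤    = s≤s (descents≤ R)
      ; covers       = covers′
      ; only         = λ where
          (here refl) → leaf , refl
          (there q)   → from-drop-last (only R q)
      ; ends-at-root = ends-at-root R
      }
      where
      covers′ : ∀ x → label T x ∈ₗ trail (label T leaf , s) (descend j ∷ w)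
      covers′ x with view x
      ... | ‵fromℕ     = here refl
      ... | ‵inject₁ y = there (covers R y)

    represents-excursion : ∀ {st w₁ w₂} j → j < D → neighbour (proj₁ (run st w₁)) j ≡ label T leaf →
                           Represents (drop-last T) st (w₁ ++ w₂) →
                           Represents T st (w₁ ++ descend j ∷ ascend ∷ w₂)
    represents-excursion {st} {w₁} {w₂} j j<D reaches-leaf R = record
      { bounded      = Allₚ.++⁺ (Allₚ.++⁻ˡ w₁ (bounded R)) (j<D ∷ tt ∷ Allₚ.++⁻ʳ w₁ (bounded R))
      ; ascents≤     = subst (_≤ suc k) (sym (ascents-excursion w₁ j)) (s≤s (ascents≤ R))
      ; descents≤    = subst (_≤ suc k) (sym (descents-excursion w₁ j)) (s≤s (descents≤ R))
      ; covers       = covers′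
      ; only         = only′
      ; ends-at-root = trans (cong proj₁ (run-excursion st w₁ j)) (ends-at-root R)
      }
      where
      covers′ : ∀ x → label T x ∈ₗ trail st (w₁ ++ descend j ∷ ascend ∷ w₂)
      covers′ x with view x
      ... | ‵fromℕ     = subst (_∈ₗ _) reaches-leaf (trail-excursion-new st w₁ j)
      ... | ‵inject₁ y = trail-excursion⁺ st w₁ j (covers R y)
      only′ : ∀ {t} → t ∈ₗ trail st (w₁ ++ descend j ∷ ascend ∷ w₂) → ∃ λ x → label T x ≡ t
      only′ q with trail-excursion⁻ st w₁ j q
      ... | inj₁ t≡ = leaf , sym (trans t≡ reaches-leaf)
      ... | inj₂ q′ = from-drop-last (only R q′)

  -- Put back the last node, a leaf: if the walk starts there, step from it to its parent
  -- first; otherwise make a detour to it when the walk passes its parent.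
  represent : ∀ {k} (T : HTree H k) → LoopFree T → ∀ x s → Σ Word (Represents T (label T x , s))
  represent {zero}  T lf zero s = [] , record
    { bounded = [] ; ascents≤ = z≤n ; descents≤ = z≤n
    ; covers = λ { zero → here refl } ; only = λ { (here refl) → zero , refl } ; ends-at-root = refl }
  represent {suc k} T lf x s with view x | parent-lowered T (fromℕ k)
  ... | ‵fromℕ | p , p≡ = descend j ∷ proj₁ rest , represents-descend T j (position<D mem) (proj₂ rest)
    where
    leaf : Fin (suc (suc k))
    leaf = fromℕ (suc k)
    mem : label T (parent T (fromℕ k)) ∈ₗ neighbours H (label T leaf)
    mem = parent∈neighbours T lf (fromℕ k)
    j : ℕ
    j = position mem
    rest : Σ Word (Represents (drop-last T) (neighbour (label T leaf) j , label T leaf ∷ s))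
    rest = subst (λ t → Σ Word (Represents (drop-last T) (t , label T leaf ∷ s)))
                 (trans (cong (label T) p≡) (sym (lookupOr-position mem)))
                 (represent (drop-last T) (drop-last-loop-free T lf) p (label T leaf ∷ s))
  ... | ‵inject₁ y | p , p≡
    with represent (drop-last T) (drop-last-loop-free T lf) y s
  ... | w , R
    with trail-split (label T (inject₁ y) , s) w
                     (subst (_∈ₗ trail (label T (inject₁ y) , s) w) (cong (label T) p≡) (covers R p))
  ... | w₁ , w₂ , refl , at-parent =
    w₁ ++ descend j ∷ ascend ∷ w₂ ,
    represents-excursion T j (position<D mem) (trans (cong (λ t → neighbour t j) at-parent)
                                                     (lookupOr-position mem)) R
    where
    mem : label T (fromℕ (suc k)) ∈ₗ neighbours H (label T (parent T (fromℕ k)))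
    mem = child∈neighbours T lf (fromℕ k)
    j : ℕ
    j = position mem

module Counting {H : Hypergraph} {D : ℕ} (degree≤D : ∀ i → edgeDegree H i ≤ D) (1≤D : 1 ≤ D)
                {v : Fin (n H)} {g : Fin (m H)} (v∈g : v ∈ edge H g) (k : ℕ) where

  open Representation {H} {D} degree≤D
  open Represents

  Describes : HTree H k → Fin (suc k) → Word → Set
  Describes T x w = (LoopFree T × Represents T (label T x , []) w) ⊎ (Degenerate T × w ≡ [])

  describe : (T : HTree H k) (x : Fin (suc k)) → Σ Word (Describes T x)
  describe T x with loop-free-or-degenerate T
  ... | inj₁ lf = map₂ (λ R → inj₁ (lf , R)) (represent T lf x [])
  ... | inj₂ dg = [] , inj₂ (dg , refl)

  describes-bounded : ∀ {T x w} → Describes T x w → All (Bounded D) w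
  describes-bounded (inj₁ (_ , R))    = bounded R
  describes-bounded (inj₂ (_ , refl)) = []

  describes-encode< : ∀ {T x w} → Describes T x w → encode D w < 2 * (4 * D) ^ k
  describes-encode< (inj₁ (_ , R))    = encode< {k = k} _ 1≤D (bounded R) (ascents≤ R) (descents≤ R)
  describes-encode< (inj₂ (_ , refl)) = encode< {k = k} [] 1≤D [] z≤n z≤n

  no-stationary-walk : ∀ {T : HTree H k} {st} → LoopFree T → Represents T st [] → Fin k → ⊥
  no-stationary-walk {T} lf R i =
    lf i (trans (at-start (covers R (suc i))) (sym (at-start (covers R (parent T i)))))
    where
    at-start : ∀ {a b : Fin (m H)} → a ∈ₗ b ∷ [] → a ≡ b
    at-start (here a≡b) = a≡b

  describes-iso : ∀ {T U x y w} → Disjoint T → Disjoint U → Describes T x w → Describes U y w →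
                  label T x ≡ label U y → Iso T U
  describes-iso {U = U} {w = w} dT dU (inj₁ (lfT , R)) (inj₁ (lfU , S)) same =
    iso-of-same-labels dT dU lfT lfU (λ x → only S′ (covers R x)) (λ y → only R (covers S′ y))
                       (trans (sym (ends-at-root R)) (ends-at-root S′))
    where
    S′ : Represents U (_ , []) w
    S′ = subst (λ t → Represents U (t , []) w) (sym same) S
  describes-iso {T = T} dT dU (inj₁ (lfT , R)) (inj₂ ((i , _) , refl)) _ =
    ⊥-elim (no-stationary-walk {T = T} lfT R i)
  describes-iso {U = U} dT dU (inj₂ ((i , _) , refl)) (inj₁ (lfU , S)) _ =
    ⊥-elim (no-stationary-walk {T = U} lfU S i)
  describes-iso dT dU (inj₂ (dgT , _)) (inj₂ (dgU , _)) same = degenerate-iso _ _ dT dgT dgU same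

  start : ∀ {f} → v ∈ edge H f → f ∈ₗ g ∷ neighbours H g
  start {f} v∈f with f Finₚ.≟ g
  ... | yes refl = here refl
  ... | no  f≢g  = there (∈-neighbours {H = H} f≢g (v , x∈p∩q⁺ (v∈g , v∈f)))

  start< : ∀ {f} (v∈f : v ∈ edge H f) → position (start v∈f) < suc D
  start< v∈f = ≤-trans (Finₚ.toℕ<n (Any.index (start v∈f))) (s≤s (degree≤D g))

  capacity : 2 * (4 * D) ^ k * suc D ≤ (4 * D) ^ suc k
  capacity = begin
    2 * (4 * D) ^ k * suc D     ≡⟨ regroup ((4 * D) ^ k) D ⟩
    (suc D * 2) * (4 * D) ^ k   ≤⟨ *-monoˡ-≤ _ (*-monoˡ-≤ 2 (+-monoˡ-≤ D 1≤D)) ⟩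
    ((D + D) * 2) * (4 * D) ^ k ≡⟨ cong (_* (4 * D) ^ k) (double D) ⟩
    (4 * D) * (4 * D) ^ k       ∎
    where
    open ≤-Reasoning
    regroup : ∀ p d → 2 * p * suc d ≡ (suc d * 2) * p
    regroup = solve-∀
    double : ∀ d → (d + d) * 2 ≡ 4 * d
    double = solve-∀

  code : DisjointHTreeContaining H v k → Fin ((4 * D) ^ suc k)
  code (T , _ , x , v∈x) =
    Fin.fromℕ< (≤-trans (digits-bound (start< v∈x) (describes-encode< (proj₂ (describe T x)))) capacity)

  code-injective : ∀ a b → code a ≡ code b → Iso (proj₁ a) (proj₁ b)
  code-injective (T , dT , x , v∈x) (U , dU , y , v∈y) eq
    with same-position , same-encoding ←
           digits-injective (encode D (proj₁ (describe T x))) (encode D (proj₁ (describe U y)))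
                            (start< v∈x) (start< v∈y) (Finₚ.fromℕ<-injective _ _ _ _ eq) =
    describes-iso dT dU (proj₂ dx) (subst (Describes U y) (sym same-word) (proj₂ dy)) same-start
    where
    dx : Σ Word (Describes T x)
    dx = describe T x
    dy : Σ Word (Describes U y)
    dy = describe U y
    same-word : proj₁ dx ≡ proj₁ dy
    same-word = encode-injective _ _ (describes-bounded (proj₂ dx)) (describes-bounded (proj₂ dy))
                                 same-encoding
    at : ℕ → Fin (m H)
    at = lookupOr g (g ∷ neighbours H g)
    same-start : label T x ≡ label U y
    same-start = begin
      label T x                 ≡⟨ lookupOr-position (start v∈x) ⟨
      at (position (start v∈x)) ≡⟨ cong at same-position ⟩
      at (position (start v∈y)) ≡⟨ lookupOr-position (start v∈y) ⟩
      label U y                 ∎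
      where open ≡-Reasoning

proposition2 : (H : Hypergraph) (D : ℕ) → MaxEdgeDegree H D → 1 ≤ D →
    (v : Fin (n H)) (k : ℕ) →
    AtMostUpTo (DisjointHTreeContaining H v k)
               (λ A B → Iso (proj₁ A) (proj₁ B))
               ((4 * D) ^ suc k)
proposition2 H D (degree≤D , _) 1≤D v k with Finₚ.any? (λ j → v ∈? edge H j)
... | yes (g , v∈g) = code , code-injective
  where open Counting degree≤D 1≤D v∈g k
... | no  ∄g        = (λ (T , _ , x , v∈x) → ⊥-elim (∄g (label T x , v∈x)))
                    , (λ (T , _ , x , v∈x) _ _ → ⊥-elim (∄g (label T x , v∈x)))
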